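{- Let $p,q$ be integers with $0\le p<q$. Then $\varphi_{p,q}(\mathbf a)\le1$ for every non-empty composition $\mathbf a$, and $\zeta_{]p,q]}(\mathbf a)\le q-p$ for every composition $\mathbf a$.
   Context: A composition is a finite sequence $\mathbf a=(a_1,\ldots,a_r)$ of positive integers ($r\ge0$). For non-empty $\mathbf a$ and $0\le p<q$: $\varphi_{p,q}(\mathbf a)=q^{ -a_1}\sum_{q>n_2>\cdots>n_r>p}n_2^{ -a_2}\cdots n_r^{ -a_r}$ (equal to $q^{ -a_1}$ if $r=1$), sum over integers. For any $\mathbf a$ and $0\le p\le q$: $\zeta_{]p,q]}(\mathbf a)=\sum_{q\ge n_1>n_2>\cdots>n_r>p}n_1^{ -a_1}\cdots n_r^{ -a_r}$ (equal to $1$ if $r=0$). -}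

module Defs where

open import Data.Nat using (ℕ; zero; suc; _+_; _∸_; _^_)
open import Data.Nat.Properties using (m^n≢0)
open import Data.Integer using (+_)
open import Data.Rational using (ℚ; 0ℚ; 1ℚ; _/_; _*_)
import Data.Rational as ℚ
open import Data.List using (List; []; _∷_; map; upTo; foldr)

-- Compositions are lists of natural numbers; positivity of the parts is
-- imposed as a hypothesis in the statement (All (0 <_) a).
Composition : Set
Composition = List ℕ

invPow : ℕ → ℕ → ℚ
invPow m a = _/_ (+ 1) (suc m ^ a) {{m^n≢0 (suc m) a}}

-- ζ_{]p,q]}(a) = Σ_{q ≥ n₁ > ... > n_r > p} n₁^{-a₁} ⋯ n_r^{-a_r}
ζ : ℕ → ℕ → Composition → ℚ
ζ p q []       = 1ℚ
ζ p q (a ∷ as) = foldr ℚ._+_ 0ℚ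
  (map (λ k → invPow (p + k) a * ζ p (p + k) as) (upTo (q ∸ p)))
  -- term k corresponds to n₁ = p + k + 1, and the remaining sum runs over
  -- ]p, n₁ - 1] = ]p, p + k]

-- φ_{p,q}(a) = q^{-a₁} Σ_{q > n₂ > ... > n_r > p} n₂^{-a₂} ⋯ n_r^{-a_r}
--            = q^{-a₁} · ζ_{]p,q-1]}(a₂,…,a_r)
φ : ℕ → ℕ → Composition → ℚ
φ p zero    as       = 0ℚ   -- never used: q > p ≥ 0 in the statement
φ p q       []       = 0ℚ   -- never used: a is non-empty in the statement
φ p (suc q) (a ∷ as) = invPow q a * ζ p q as

{-# OPTIONS --safe #-}
-- Splitting off the largest index, ζ_{]p,q]}(a₁,…,a_r) = Σ_{p<n≤q} φ_{p,n}(a₁,…,a_r) and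
-- φ_{p,n}(a₁,…,a_r) = n^{-a₁} ζ_{]p,n-1]}(a₂,…,a_r). Induction on r gives ζ_{]p,q]} ≤ q − p + 1
-- (the 1 accounting for the empty composition), hence φ_{p,n} ≤ n^{-a₁}(n − p) ≤ n^{1-a₁} ≤ 1,
-- and summing q − p such terms gives ζ_{]p,q]} ≤ q − p for non-empty compositions.
module Submission where

open import Defs
open import Data.Nat using (ℕ; _<_; _∸_)
open import Data.Integer using (+_)
open import Data.Rational using (ℚ; 1ℚ; _≤_; _/_)
open import Data.List using (List; _∷_)
open import Data.List.Relation.Unary.All using (All)
open import Data.Product using (_×_)

open import Data.Nat as ℕ using (suc; _^_; NonZero; s≤s)
import Data.Nat.Properties as ℕₚ
import Data.Integer as ℤ
import Data.Integer.Properties as ℤₚ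
open import Data.Rational as ℚ using (0ℚ; fromℚᵘ)
import Data.Rational.Properties as ℚₚ
open import Data.Rational.Unnormalised as ℚᵘ using (ℚᵘ; mkℚᵘ; *≤*; *≡*)
import Data.Rational.Unnormalised.Properties as ℚᵘₚ
open import Data.List using ([]; map; upTo; foldr; length)
import Data.List.Properties as Listₚ
open import Data.List.Relation.Unary.All using (_∷_)
open import Data.Product using (_,_)
open import Relation.Binary.PropositionalEquality
  using (_≡_; sym; cong; cong₂; subst; subst₂)
open import Relation.Binary.PropositionalEquality.Properties using (module ≡-Reasoning)

-- ℚ normalises fractions by a gcd, which blocks computation; the arithmetic of fractions
-- below is done on unnormalised representatives and transported along fromℚᵘ.

fromℚᵘ-mono-≤ : ∀ {p q} → p ℚᵘ.≤ q → fromℚᵘ p ≤ fromℚᵘ q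
fromℚᵘ-mono-≤ {p} {q} p≤q = ℚₚ.toℚᵘ-cancel-≤
  (ℚᵘₚ.≤-respˡ-≃ (ℚᵘₚ.≃-sym (ℚₚ.toℚᵘ-fromℚᵘ p))
    (ℚᵘₚ.≤-respʳ-≃ (ℚᵘₚ.≃-sym (ℚₚ.toℚᵘ-fromℚᵘ q)) p≤q))

fromℚᵘ-homo-+ : ∀ p q → fromℚᵘ (p ℚᵘ.+ q) ≡ fromℚᵘ p ℚ.+ fromℚᵘ q
fromℚᵘ-homo-+ p q = ℚₚ.toℚᵘ-injective (ℚᵘₚ.≃-trans (ℚₚ.toℚᵘ-fromℚᵘ (p ℚᵘ.+ q))
  (ℚᵘₚ.≃-sym (ℚᵘₚ.≃-trans (ℚₚ.toℚᵘ-homo-+ (fromℚᵘ p) (fromℚᵘ q))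
    (ℚᵘₚ.+-cong (ℚₚ.toℚᵘ-fromℚᵘ p) (ℚₚ.toℚᵘ-fromℚᵘ q)))))

fromℚᵘ-homo-* : ∀ p q → fromℚᵘ (p ℚᵘ.* q) ≡ fromℚᵘ p ℚ.* fromℚᵘ q
fromℚᵘ-homo-* p q = ℚₚ.toℚᵘ-injective (ℚᵘₚ.≃-trans (ℚₚ.toℚᵘ-fromℚᵘ (p ℚᵘ.* q))
  (ℚᵘₚ.≃-sym (ℚᵘₚ.≃-trans (ℚₚ.toℚᵘ-homo-* (fromℚᵘ p) (fromℚᵘ q))
    (ℚᵘₚ.*-cong (ℚₚ.toℚᵘ-fromℚᵘ p) (ℚₚ.toℚᵘ-fromℚᵘ q)))))

/-≤-/ : ∀ m n s t .{{_ : NonZero n}} .{{_ : NonZero t}} →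
        m ℕ.* t ℕ.≤ s ℕ.* n → + m / n ≤ + s / t
/-≤-/ m (suc n) s (suc t) mt≤sn = fromℚᵘ-mono-≤ {mkℚᵘ (+ m) n} {mkℚᵘ (+ s) t}
  (*≤* (subst₂ ℤ._≤_ (ℤₚ.pos-* m (suc t)) (ℤₚ.pos-* s (suc n)) (ℤ.+≤+ mt≤sn)))

/1-mono-≤ : ∀ {m n} → m ℕ.≤ n → + m / 1 ≤ + n / 1
/1-mono-≤ {m} {n} m≤n = /-≤-/ m 1 n 1 (ℕₚ.*-monoˡ-≤ 1 m≤n)

1+/1≡suc/1 : ∀ n → 1ℚ ℚ.+ + n / 1 ≡ + suc n / 1
1+/1≡suc/1 n = begin
  1ℚ ℚ.+ + n / 1                  ≡⟨ fromℚᵘ-homo-+ ℚᵘ.1ℚᵘ n/1 ⟨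
  fromℚᵘ (ℚᵘ.1ℚᵘ ℚᵘ.+ n/1)        ≡⟨ ℚₚ.fromℚᵘ-cong {ℚᵘ.1ℚᵘ ℚᵘ.+ n/1} {+ suc n ℚᵘ./ 1} 1+n≃suc ⟩
  + suc n / 1                     ∎
  where
  open ≡-Reasoning
  n/1 : ℚᵘ
  n/1 = + n ℚᵘ./ 1
  1+n≃suc : ℚᵘ.1ℚᵘ ℚᵘ.+ n/1 ℚᵘ.≃ + suc n ℚᵘ./ 1
  1+n≃suc = *≡* (cong (λ k → (+ 1 ℤ.+ k) ℤ.* + 1) (ℤₚ.*-identityʳ (+ n)))

1/-*-/1 : ∀ d n .{{_ : NonZero d}} → (+ 1 / d) ℚ.* (+ n / 1) ≡ + n / d
1/-*-/1 (suc d) n = begin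
  (+ 1 / suc d) ℚ.* (+ n / 1)     ≡⟨ fromℚᵘ-homo-* 1/d n/1 ⟨
  fromℚᵘ (1/d ℚᵘ.* n/1)           ≡⟨ ℚₚ.fromℚᵘ-cong {1/d ℚᵘ.* n/1} {+ n ℚᵘ./ suc d} 1/d*n≃n/d ⟩
  + n / suc d                     ∎
  where
  open ≡-Reasoning
  1/d n/1 : ℚᵘ
  1/d = + 1 ℚᵘ./ suc d
  n/1 = + n ℚᵘ./ 1
  1/d*n≃n/d : 1/d ℚᵘ.* n/1 ℚᵘ.≃ + n ℚᵘ./ suc d
  1/d*n≃n/d = *≡* (cong₂ ℤ._*_ (ℤₚ.*-identityˡ (+ n)) (cong +_ (sym (ℕₚ.*-identityʳ (suc d)))))

/-≤-1 : ∀ n d .{{_ : NonZero d}} → n ℕ.≤ d → + n / d ≤ 1ℚ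
/-≤-1 n d n≤d = /-≤-/ n d 1 1 (subst₂ ℕ._≤_ (sym (ℕₚ.*-identityʳ n)) (sym (ℕₚ.*-identityˡ d)) n≤d)

m≤m^n : ∀ m .{{_ : NonZero m}} {n} → 0 < n → m ℕ.≤ m ^ n
m≤m^n m {n} 0<n = subst (ℕ._≤ m ^ n) (ℕₚ.^-identityʳ m) (ℕₚ.^-monoʳ-≤ m 0<n)

sum-≤-length : ∀ {A : Set} (f : A → ℚ) xs → (∀ x → f x ≤ 1ℚ) →
               foldr ℚ._+_ 0ℚ (map f xs) ≤ + length xs / 1
sum-≤-length f []       f≤1 = ℚₚ.≤-refl
sum-≤-length f (x ∷ xs) f≤1 = subst (f x ℚ.+ foldr ℚ._+_ 0ℚ (map f xs) ≤_) (1+/1≡suc/1 (length xs))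
  (ℚₚ.+-mono-≤ (f≤1 x) (sum-≤-length f xs f≤1))

invPow-*-≤-1 : ∀ m a {x} → 0 < a → x ≤ + suc m / 1 → invPow m a ℚ.* x ≤ 1ℚ
invPow-*-≤-1 m a {x} 0<a x≤m+1 = begin
  invPow m a ℚ.* x                  ≤⟨ ℚₚ.*-monoˡ-≤-nonNeg (invPow m a) {{invPow-nonNeg}} x≤m+1 ⟩
  invPow m a ℚ.* (+ suc m / 1)      ≡⟨ 1/-*-/1 (suc m ^ a) (suc m) ⟩
  + suc m / suc m ^ a               ≤⟨ /-≤-1 (suc m) (suc m ^ a) (m≤m^n (suc m) 0<a) ⟩
  1ℚ                                ∎
  where
  open ℚₚ.≤-Reasoning
  instance
    _ : NonZero (suc m ^ a)
    _ = ℕₚ.m^n≢0 (suc m) a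
  invPow-nonNeg : ℚ.NonNegative (invPow m a)
  invPow-nonNeg = ℚₚ.normalize-nonNeg 1 (suc m ^ a)

φ-≤-1 : ∀ p q a as → 0 < a → ζ p q as ≤ + suc (q ∸ p) / 1 → φ p (suc q) (a ∷ as) ≤ 1ℚ
φ-≤-1 p q a as 0<a ζ≤ = invPow-*-≤-1 q a 0<a
  (ℚₚ.≤-trans ζ≤ (/1-mono-≤ (s≤s (ℕₚ.m∸n≤m q p))))

-- The k-th summand of ζ p q (a ∷ as) is definitionally φ p (suc (p + k)) (a ∷ as).
ζ-∷-≤ : ∀ p q a as → 0 < a → (∀ r → ζ p r as ≤ + suc (r ∸ p) / 1) →
        ζ p q (a ∷ as) ≤ + (q ∸ p) / 1
ζ-∷-≤ p q a as 0<a ζ≤ = subst (λ n → ζ p q (a ∷ as) ≤ + n / 1) (Listₚ.length-upTo (q ∸ p))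
  (sum-≤-length (λ k → φ p (suc (p ℕ.+ k)) (a ∷ as)) (upTo (q ∸ p))
    (λ k → φ-≤-1 p (p ℕ.+ k) a as 0<a (ζ≤ (p ℕ.+ k))))

ζ-≤-suc : ∀ p q as → All (0 <_) as → ζ p q as ≤ + suc (q ∸ p) / 1
ζ-≤-suc p q []       _           = /1-mono-≤ (s≤s (ℕ.z≤n {q ∸ p}))
ζ-≤-suc p q (a ∷ as) (0<a ∷ as>0) = ℚₚ.≤-trans
  (ζ-∷-≤ p q a as 0<a (λ r → ζ-≤-suc p r as as>0)) (/1-mono-≤ (ℕₚ.n≤1+n (q ∸ p)))

proposition7 : (p q : ℕ) → p < q →
    ((a : ℕ) (as : List ℕ) → All (0 <_) (a ∷ as) → φ p q (a ∷ as) ≤ 1ℚ)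
    × ((as : List ℕ) → All (0 <_) as → ζ p q as ≤ (+ (q ∸ p)) / 1)
proposition7 p (suc q) p<q = φ≤1 , ζ≤q-p
  where
  φ≤1 : (a : ℕ) (as : List ℕ) → All (0 <_) (a ∷ as) → φ p (suc q) (a ∷ as) ≤ 1ℚ
  φ≤1 a as (0<a ∷ as>0) = φ-≤-1 p q a as 0<a (ζ-≤-suc p q as as>0)

  ζ≤q-p : (as : List ℕ) → All (0 <_) as → ζ p (suc q) as ≤ + (suc q ∸ p) / 1
  ζ≤q-p []       _            = /1-mono-≤ (ℕₚ.m<n⇒0<n∸m p<q)
  ζ≤q-p (a ∷ as) (0<a ∷ as>0) = ζ-∷-≤ p (suc q) a as 0<a (λ r → ζ-≤-suc p r as as>0)
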